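{- If $n$ is an overpseudoprime to base 2 and $n$ is not divisible by $p^2$ for any Wieferich prime $p$, then $n$ is squarefree.
   Context: A prime $p$ is a Wieferich prime if $2^{p-1}\equiv 1\pmod{p^2}$. For an odd integer $m>1$, $h(m)$ denotes the multiplicative order of 2 modulo $m$. The cyclotomic cosets of 2 modulo $m$ are the orbits of $\{1,2,\ldots,m-1\}$ under $x\mapsto 2x \bmod m$; $r(m)$ is their number. An odd composite number $n$ is called an overpseudoprime to base 2 if $n=r(n)h(n)+1$. -}

module Defs where

open import Data.Nat using (ℕ; zero; suc; _+_; _*_; _^_; _∸_; _≤_; _<_; NonZero)
open import Data.Nat.Divisibility using (_∣_)
open import Data.Nat.Primality using (Prime)
open import Data.Nat.DivMod using (_%_)
open import Data.Product using (Σ; ∃; _×_; _,_)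
open import Data.Fin using (Fin)
open import Relation.Binary.PropositionalEquality using (_≡_; _≢_)
open import Relation.Nullary using (¬_)

IsOrder2 : (m : ℕ) → .{{NonZero m}} → ℕ → Set
IsOrder2 m k = (1 ≤ k) × ((2 ^ k) % m ≡ 1 % m)
             × (∀ j → 1 ≤ j → j < k → (2 ^ j) % m ≢ 1 % m)

InCoset : (m : ℕ) → .{{NonZero m}} → ℕ → ℕ → Set
InCoset m x y = ∃ λ j → (2 ^ j * x) % m ≡ y

IsNumCosets : (m : ℕ) → .{{NonZero m}} → ℕ → Set
IsNumCosets m r = Σ (Fin r → ℕ) λ rep →
    (∀ i → (1 ≤ rep i) × (rep i < m))
  × (∀ i i′ → InCoset m (rep i) (rep i′) → i ≡ i′)
  × (∀ x → 1 ≤ x → x < m → ∃ λ i → InCoset m (rep i) x)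

-- p is a Wieferich prime: p prime and 2^(p-1) ≡ 1 (mod p²).
-- (Since 2^(p-1) ≥ 1, this is p² ∣ 2^(p-1) - 1.)
Wieferich : ℕ → Set
Wieferich p = Prime p × (p * p ∣ (2 ^ (p ∸ 1)) ∸ 1)

SquareFree : ℕ → Set
SquareFree n = ∀ p → Prime p → ¬ (p * p ∣ n)

{-# OPTIONS --safe #-}
-- Let h be the order of 2 modulo n and r the number of cyclotomic cosets, and suppose p² ∣ n
-- for a prime p that is not Wieferich. The order k of 2 modulo p divides h, and k ≠ h: otherwise
-- 2^k ≡ 1 (mod n), hence (mod p²), and as k ∣ p - 1 by Fermat also 2^(p-1) ≡ 1 (mod p²).
-- Since 2^k ≡ 1 (mod p), doubling k times fixes n/p modulo n, so the coset of n/p has fewer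
-- than h elements. The r·h pairs (coset representative, exponent) cover all n - 1 elements of
-- {1,…,n-1} and two of them give the same element, so n - 1 < r·h, contradicting n = r·h + 1.
module Submission where

open import Defs
open import Data.Nat using (ℕ; _+_; _*_; _<_; NonZero)
open import Data.Nat.Divisibility using (_∣_)
open import Data.Nat.Primality using (Composite)
open import Data.Nat.DivMod using (_%_)
open import Relation.Binary.PropositionalEquality using (_≡_)
open import Relation.Nullary using (¬_)

open import Data.Fin as Fin using (Fin; toℕ; combine; remQuot)
import Data.Fin.Properties as Fin
open import Data.Nat
open import Data.Nat.Combinatorics
open import Data.Nat.DivMod
open import Data.Nat.Divisibility
open import Data.Nat.Induction using (<-rec)
open import Data.Nat.Primality
open import Data.Nat.Properties
open import Data.Nat.Tactic.RingSolver using (solve-∀)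
open import Data.Product
open import Data.Sum using (_⊎_; inj₁; inj₂)
open import Data.Vec.Functional using (_∷_)
open import Function.Base using (_∘_; id)
open import Function.Definitions using (Injective)
open import Relation.Binary.Definitions using (tri<; tri≈; tri>)
open import Relation.Binary.PropositionalEquality
open import Relation.Nullary using (Dec; yes; no; contradiction)
open import Relation.Nullary.Decidable using (_×-dec_; _→-dec_; ¬?; map′)
open import Relation.Unary using (Pred; Decidable)
open import Algebra.Properties.CommutativeSemigroup *-commutativeSemigroup using (x∙yz≈y∙xz)
open import Algebra.Properties.CommutativeSemiring.Binomial +-*-commutativeSemiring as Binomial
  using (binomialExpansion)
open import Algebra.Properties.Semiring.Sum +-*-semiring using (sum; sum-init-last; sum-cong-≗)
import Algebra.Properties.Semiring.Exp +-*-semiring as Semiring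
import Algebra.Definitions.RawMonoid +-0-rawMonoid as Monoid

infix 4 _≡_[mod_]
_≡_[mod_] : ℕ → ℕ → (m : ℕ) → .{{NonZero m}} → Set
a ≡ b [mod m ] = a % m ≡ b % m

module _ {m : ℕ} .{{_ : NonZero m}} where

  %-≡-mod : ∀ a → a % m ≡ a [mod m ]
  %-≡-mod a = m%n%n≡m%n a m

  *-cong-mod : ∀ {a b c d} → a ≡ b [mod m ] → c ≡ d [mod m ] → a * c ≡ b * d [mod m ]
  *-cong-mod {a} {b} {c} {d} a≡b c≡d = begin
    (a * c) % m               ≡⟨ %-distribˡ-* a c m ⟩
    ((a % m) * (c % m)) % m   ≡⟨ cong₂ (λ x y → (x * y) % m) a≡b c≡d ⟩
    ((b % m) * (d % m)) % m   ≡⟨ %-distribˡ-* b d m ⟨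
    (b * d) % m               ∎
    where open ≡-Reasoning

  *-congˡ-mod : ∀ a {c d} → c ≡ d [mod m ] → a * c ≡ a * d [mod m ]
  *-congˡ-mod a = *-cong-mod {a} {a} refl

  ^-cong-mod : ∀ {a b} → a ≡ b [mod m ] → ∀ e → a ^ e ≡ b ^ e [mod m ]
  ^-cong-mod a≡b zero    = refl
  ^-cong-mod a≡b (suc e) = *-cong-mod a≡b (^-cong-mod a≡b e)

  ≡1-mod⇒^≡1 : ∀ {a} → a ≡ 1 [mod m ] → ∀ e → a ^ e ≡ 1 [mod m ]
  ≡1-mod⇒^≡1 a≡1 e = trans (^-cong-mod a≡1 e) (cong (_% m) (^-zeroˡ e))

  ∣⇒^≡1-mod : ∀ {a k j} → a ^ k ≡ 1 [mod m ] → k ∣ j → a ^ j ≡ 1 [mod m ]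
  ∣⇒^≡1-mod {a} {k} a^k≡1 (divides q refl) =
    subst (_≡ 1 [mod m ]) (trans (^-*-assoc a k q) (cong (a ^_) (*-comm k q))) (≡1-mod⇒^≡1 a^k≡1 q)

  ≡1-mod⇒∣∸1 : 1 < m → ∀ {a} → a ≡ 1 [mod m ] → m ∣ a ∸ 1
  ≡1-mod⇒∣∸1 1<m {a} a≡1 = divides (a / m) (begin
    a ∸ 1                     ≡⟨ cong (_∸ 1) (m≡m%n+[m/n]*n a m) ⟩
    (a % m + a / m * m) ∸ 1   ≡⟨ cong (λ r → (r + a / m * m) ∸ 1) (trans a≡1 (m<n⇒m%n≡m 1<m)) ⟩
    a / m * m                 ∎)
    where open ≡-Reasoning

  module _ (m-odd : m % 2 ≡ 1) where

    -- m = 1 + 2⌊m/2⌋, so 2 · (1 + ⌊m/2⌋) = m + 1.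
    half-inverse : ∀ a → suc (m / 2) * (2 * a) ≡ a [mod m ]
    half-inverse a = begin
      (suc t * (2 * a)) % m       ≡⟨ cong (_% m) (identity a t) ⟩
      (a + a * (1 + t * 2)) % m   ≡⟨ cong (λ m′ → (a + a * m′) % m) m≡1+2t ⟨
      (a + a * m) % m             ≡⟨ [m+kn]%n≡m%n a a m ⟩
      a % m                       ∎
      where
      open ≡-Reasoning
      t = m / 2
      m≡1+2t : m ≡ 1 + t * 2
      m≡1+2t = trans (m≡m%n+[m/n]*n m 2) (cong (_+ t * 2) m-odd)
      identity : ∀ a t → suc t * (2 * a) ≡ a + a * (1 + t * 2)
      identity = solve-∀

    *-cancelˡ-2-mod : ∀ {a b} → 2 * a ≡ 2 * b [mod m ] → a ≡ b [mod m ]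
    *-cancelˡ-2-mod {a} {b} 2a≡2b =
      trans (sym (half-inverse a)) (trans (*-congˡ-mod (suc (m / 2)) 2a≡2b) (half-inverse b))

    *-cancelˡ-2^-mod : ∀ j {a b} → 2 ^ j * a ≡ 2 ^ j * b [mod m ] → a ≡ b [mod m ]
    *-cancelˡ-2^-mod zero    {a} {b} eq = subst₂ _≡_[mod m ] (*-identityˡ a) (*-identityˡ b) eq
    *-cancelˡ-2^-mod (suc j) {a} {b} eq = *-cancelˡ-2^-mod j (*-cancelˡ-2-mod
      (subst₂ _≡_[mod m ] (*-assoc 2 (2 ^ j) a) (*-assoc 2 (2 ^ j) b) eq))

≡-mod-∣ : ∀ {d m a b} .{{_ : NonZero d}} .{{_ : NonZero m}} → d ∣ m → a ≡ b [mod m ] → a ≡ b [mod d ]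
≡-mod-∣ {d} {m} {a} {b} d∣m a≡b =
  trans (sym (m∣n⇒o%n%m≡o%m d m a d∣m)) (trans (cong (_% d) a≡b) (m∣n⇒o%n%m≡o%m d m b d∣m))

∣-odd : ∀ {d n} → d ∣ n → n % 2 ≡ 1 → d % 2 ≡ 1
∣-odd {d} {n} d∣n n-odd with d % 2 in d%2≡
... | 0           = contradiction (trans (sym n-odd) (n∣m⇒m%n≡0 n 2 2∣n)) λ ()
  where
  2∣n : 2 ∣ n
  2∣n = ∣-trans (m%n≡0⇒n∣m d 2 d%2≡) d∣n
... | 1           = refl
... | suc (suc _) = contradiction (subst (_< 2) d%2≡ (m%n<n d 2)) λ { (s≤s (s≤s ())) }

^≡Semiring^ : ∀ a n → a ^ n ≡ a Semiring.^ n
^≡Semiring^ a zero    = refl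
^≡Semiring^ a (suc n) = cong (a *_) (^≡Semiring^ a n)

×≡* : ∀ n a → n Monoid.× a ≡ n * a
×≡* zero    a = refl
×≡* (suc n) a = cong (a +_) (×≡* n a)

2^n≡∑nCk : ∀ n → 2 ^ n ≡ sum {suc n} (λ k → n C toℕ k)
2^n≡∑nCk n = begin
  2 ^ n                           ≡⟨ ^≡Semiring^ 2 n ⟩
  (1 + 1) Semiring.^ n            ≡⟨ Binomial.theorem n 1 1 ⟩
  binomialExpansion 1 1 n         ≡⟨ sum-cong-≗ {suc n} term≡nCk ⟩
  sum {suc n} (λ k → n C toℕ k)   ∎
  where
  open ≡-Reasoning
  term≡nCk : ∀ k → (n C toℕ k) Monoid.× (1 Semiring.^ toℕ k * 1 Semiring.^ (n ∸ toℕ k)) ≡ n C toℕ k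
  term≡nCk k = begin
    (n C toℕ k) Monoid.× (1 Semiring.^ toℕ k * 1 Semiring.^ (n ∸ toℕ k))
      ≡⟨ ×≡* (n C toℕ k) _ ⟩
    (n C toℕ k) * (1 Semiring.^ toℕ k * 1 Semiring.^ (n ∸ toℕ k))
      ≡⟨ cong ((n C toℕ k) *_) (cong₂ _*_ (1^≡1 (toℕ k)) (1^≡1 (n ∸ toℕ k))) ⟩
    (n C toℕ k) * 1
      ≡⟨ *-identityʳ (n C toℕ k) ⟩
    n C toℕ k ∎
    where
    1^≡1 : ∀ e → 1 Semiring.^ e ≡ 1
    1^≡1 e = trans (sym (^≡Semiring^ 1 e)) (^-zeroˡ e)

∣-sum : ∀ {d n} (f : Fin n → ℕ) → (∀ i → d ∣ f i) → d ∣ sum f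
∣-sum {n = zero}  f d∣f = _ ∣0
∣-sum {n = suc n} f d∣f = ∣m∣n⇒∣m+n (d∣f Fin.zero) (∣-sum (f ∘ Fin.suc) (d∣f ∘ Fin.suc))

prime∤! : ∀ {p n} → Prime p → n < p → ¬ p ∣ n !
prime∤! {n = zero}  pr 0<p p∣1 = <⇒≱ (nonTrivial⇒n>1 _ {{prime⇒nonTrivial pr}}) (∣⇒≤ p∣1)
prime∤! {n = suc n} pr n<p p∣n! with euclidsLemma (suc n) (n !) pr p∣n!
... | inj₁ p∣1+n = <⇒≱ n<p (∣⇒≤ p∣1+n)
... | inj₂ p∣n!  = prime∤! pr (<-trans (n<1+n n) n<p) p∣n!

prime∣pCk : ∀ {p k} → Prime p → 0 < k → k < p → p ∣ p C k
prime∣pCk {p@(suc q)} {k} pr 0<k k<p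
  with euclidsLemma (p C k) (k ! * (p ∸ k) !) pr p∣pCk*k![p∸k]!
  where
  p∣pCk*k![p∸k]! : p ∣ (p C k) * (k ! * (p ∸ k) !)
  p∣pCk*k![p∸k]! = subst (p ∣_) p!≡ (m∣m*n (q !))
    where
    p!≡ : p ! ≡ (p C k) * (k ! * (p ∸ k) !)
    p!≡ = sym (trans (cong (_* (k ! * (p ∸ k) !)) (nCk≡n!/k![n-k]! (<⇒≤ k<p)))
                     (m/n*n≡m {{k !* (p ∸ k) !≢0}} (k![n∸k]!∣n! (<⇒≤ k<p))))
... | inj₁ p∣pCk = p∣pCk
... | inj₂ p∣k![p∸k]! with euclidsLemma (k !) ((p ∸ k) !) pr p∣k![p∸k]!
...   | inj₁ p∣k!     = contradiction p∣k! (prime∤! pr k<p)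
...   | inj₂ p∣[p∸k]! = contradiction p∣[p∸k]! (prime∤! pr (∸-monoʳ-< 0<k (<⇒≤ k<p)))

fermat : ∀ {p} .{{_ : NonZero p}} → Prime p → 2 ^ p ≡ 2 [mod p ]
fermat {p@(suc q)} pr = begin
  2 ^ p % p                             ≡⟨ cong (_% p) (2^n≡∑nCk p) ⟩
  sum {suc p} (λ k → p C toℕ k) % p     ≡⟨ cong (_% p) (sum-init-last {p} (λ k → p C toℕ k)) ⟩
  (1 + M + p C toℕ (Fin.fromℕ p)) % p   ≡⟨ cong (λ c → (1 + M + p C c) % p) (Fin.toℕ-fromℕ p) ⟩
  (1 + M + p C p) % p                   ≡⟨ cong (λ c → (1 + M + c) % p) (nCn≡1 p) ⟩
  (1 + M + 1) % p                       ≡⟨ cong (_% p) (+-comm (1 + M) 1) ⟩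
  (2 + M) % p                           ≡⟨ %-remove-+ʳ 2 (∣-sum _ p∣middle) ⟩
  2 % p                                 ∎
  where
  open ≡-Reasoning
  M = sum {q} (λ k → p C suc (toℕ (Fin.inject₁ k)))
  p∣middle : ∀ k → p ∣ p C suc (toℕ (Fin.inject₁ k))
  p∣middle k = prime∣pCk pr (s≤s z≤n) (s≤s (subst (_< q) (sym (Fin.toℕ-inject₁ k)) (Fin.toℕ<n k)))

module _ {ℓ} {P : Pred ℕ ℓ} (P? : Decidable P) where

  Minimal : ℕ → Set ℓ
  Minimal k = P k × (∀ {j} → j < k → ¬ P j)

  minimal-exists : ∀ {K} → P K → ∃ Minimal
  minimal-exists {K} = <-rec (λ K → P K → ∃ Minimal) search K
    where
    search : ∀ K → (∀ {j} → j < K → P j → ∃ Minimal) → P K → ∃ Minimal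
    search K smaller PK with anyUpTo? P? K
    ... | yes (j , j<K , Pj) = smaller j<K Pj
    ... | no  none           = K , PK , λ j<K Pj → none (_ , j<K , Pj)

module _ {m : ℕ} .{{_ : NonZero m}} (m-odd : m % 2 ≡ 1) where

  2^-period : ∀ {i j} → i < j → 2 ^ i ≡ 2 ^ j [mod m ] → 2 ^ (j ∸ i) ≡ 1 [mod m ]
  2^-period {i} {j} i<j 2^i≡2^j = sym (*-cancelˡ-2^-mod m-odd i (begin
    (2 ^ i * 1) % m             ≡⟨ cong (_% m) (*-identityʳ (2 ^ i)) ⟩
    2 ^ i % m                   ≡⟨ 2^i≡2^j ⟩
    2 ^ j % m                   ≡⟨ cong (λ e → 2 ^ e % m) (m+[n∸m]≡n (<⇒≤ i<j)) ⟨
    2 ^ (i + (j ∸ i)) % m       ≡⟨ cong (_% m) (^-distribˡ-+-* 2 i (j ∸ i)) ⟩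
    (2 ^ i * 2 ^ (j ∸ i)) % m   ∎))
    where open ≡-Reasoning

  2^k≡1-exists : ∃ λ k → 1 ≤ k × 2 ^ k ≡ 1 [mod m ]
  2^k≡1-exists with i , j , i<j , same ← Fin.pigeonhole (n<1+n m) (λ i → Fin.fromℕ< (m%n<n (2 ^ toℕ i) m)) =
    toℕ j ∸ toℕ i , m<n⇒0<n∸m i<j ,
    2^-period i<j (Fin.fromℕ<-injective _ _ (m%n<n _ m) (m%n<n _ m) same)

  order-exists : ∃ (IsOrder2 m)
  order-exists with k , (1≤k , 2^k≡1) , below ← minimal-exists (λ k → 1 ≤? k ×-dec 2 ^ k % m ≟ 1 % m)
                                                              (proj₂ 2^k≡1-exists) =
    k , 1≤k , 2^k≡1 , λ j 1≤j j<k 2^j≡1 → below j<k (1≤j , 2^j≡1)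

module Order {m : ℕ} .{{_ : NonZero m}} {k : ℕ} (k-order : IsOrder2 m k) where

  instance
    order-nonZero : NonZero k
    order-nonZero = >-nonZero (proj₁ k-order)

  ∣order⇒2^≡1 : ∀ {j} → k ∣ j → 2 ^ j ≡ 1 [mod m ]
  ∣order⇒2^≡1 = ∣⇒^≡1-mod (proj₁ (proj₂ k-order))

  2^≡2^%order : ∀ j → 2 ^ j ≡ 2 ^ (j % k) [mod m ]
  2^≡2^%order j = begin
    2 ^ j % m                             ≡⟨ cong (λ e → 2 ^ e % m) (m≡m%n+[m/n]*n j k) ⟩
    2 ^ (j % k + j / k * k) % m           ≡⟨ cong (_% m) (^-distribˡ-+-* 2 (j % k) (j / k * k)) ⟩
    (2 ^ (j % k) * 2 ^ (j / k * k)) % m   ≡⟨ *-congˡ-mod (2 ^ (j % k)) (∣order⇒2^≡1 (n∣m*n (j / k))) ⟩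
    (2 ^ (j % k) * 1) % m                 ≡⟨ cong (_% m) (*-identityʳ (2 ^ (j % k))) ⟩
    2 ^ (j % k) % m                       ∎
    where open ≡-Reasoning

  2^≡1⇒order∣ : ∀ {j} → 2 ^ j ≡ 1 [mod m ] → k ∣ j
  2^≡1⇒order∣ {j} 2^j≡1 with j % k in j%k≡
  ... | zero  = m%n≡0⇒n∣m j k j%k≡
  ... | suc r = contradiction (trans (sym (subst (λ e → 2 ^ j ≡ 2 ^ e [mod m ]) j%k≡ (2^≡2^%order j))) 2^j≡1)
                  (proj₂ (proj₂ k-order) (suc r) (s≤s z≤n) (subst (_< k) j%k≡ (m%n<n j k)))

record Enumeration {ℓ} (Q : Pred ℕ ℓ) (M : ℕ) : Set ℓ where
  field
    size      : ℕ
    elem      : Fin size → ℕ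
    injective : Injective _≡_ _≡_ elem
    elem<M    : ∀ i → elem i < M
    elem∈Q    : ∀ i → Q (elem i)
    complete  : ∀ {x} → x < M → Q x → ∃ λ i → elem i ≡ x

enumerate : ∀ {ℓ} {Q : Pred ℕ ℓ} → Decidable Q → ∀ M → Enumeration Q M
enumerate Q? zero = record
  { size = 0 ; elem = λ () ; injective = λ {} ; elem<M = λ () ; elem∈Q = λ () ; complete = λ () }
enumerate {Q = Q} Q? (suc M) with enumerate Q? M | Q? M
... | E | no ¬QM = record
  { size = size ; elem = elem ; injective = injective ; elem∈Q = elem∈Q
  ; elem<M = m<n⇒m<1+n ∘ elem<M
  ; complete = complete′ ∘ m<1+n⇒m<n∨m≡n }
  where
  open Enumeration E
  complete′ : ∀ {x} → x < M ⊎ x ≡ M → Q x → ∃ λ i → elem i ≡ x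
  complete′ (inj₁ x<M)  Qx = complete x<M Qx
  complete′ (inj₂ refl) Qx = contradiction Qx ¬QM
... | E | yes QM = record
  { size = suc size ; elem = M ∷ elem ; injective = injective′ ; elem<M = elem<1+M
  ; elem∈Q = λ { Fin.zero → QM ; (Fin.suc i) → elem∈Q i }
  ; complete = complete′ ∘ m<1+n⇒m<n∨m≡n }
  where
  open Enumeration E
  injective′ : Injective _≡_ _≡_ (M ∷ elem)
  injective′ {Fin.zero}  {Fin.zero}  _  = refl
  injective′ {Fin.zero}  {Fin.suc j} eq = contradiction (sym eq) (<⇒≢ (elem<M j))
  injective′ {Fin.suc i} {Fin.zero}  eq = contradiction eq (<⇒≢ (elem<M i))
  injective′ {Fin.suc i} {Fin.suc j} eq = cong Fin.suc (injective eq)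
  elem<1+M : ∀ i → (M ∷ elem) i < suc M
  elem<1+M Fin.zero    = ≤-refl
  elem<1+M (Fin.suc i) = m<n⇒m<1+n (elem<M i)
  complete′ : ∀ {x} → x < M ⊎ x ≡ M → Q x → ∃ λ i → (M ∷ elem) i ≡ x
  complete′ (inj₁ x<M)  Qx = map Fin.suc id (complete x<M Qx)
  complete′ (inj₂ refl) _  = Fin.zero , refl

module Cosets {n : ℕ} .{{_ : NonZero n}} {h : ℕ} (h-order : IsOrder2 n h) where

  open Order h-order

  2^*-compose : ∀ a b x → 2 ^ b * (2 ^ a * x % n) ≡ 2 ^ (b + a) * x [mod n ]
  2^*-compose a b x = begin
    2 ^ b * (2 ^ a * x % n) % n   ≡⟨ *-congˡ-mod (2 ^ b) (%-≡-mod (2 ^ a * x)) ⟩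
    2 ^ b * (2 ^ a * x) % n       ≡⟨ cong (_% n) (*-assoc (2 ^ b) (2 ^ a) x) ⟨
    2 ^ b * 2 ^ a * x % n         ≡⟨ cong (λ c → c * x % n) (^-distribˡ-+-* 2 b a) ⟨
    2 ^ (b + a) * x % n           ∎
    where open ≡-Reasoning

  inCoset? : ∀ x y → Dec (InCoset n x y)
  inCoset? x y = map′ (λ (j , _ , e) → j , e)
                      (λ (j , e) → j % h , m%n<n j h , trans (sym (*-cong-mod (2^≡2^%order j) refl)) e)
                      (anyUpTo? (λ j → 2 ^ j * x % n ≟ y) h)

  inCoset-refl : ∀ {x} → x < n → InCoset n x x
  inCoset-refl {x} x<n = 0 , trans (cong (_% n) (*-identityˡ x)) (m<n⇒m%n≡m x<n)

  inCoset-trans : ∀ {x y z} → InCoset n x y → InCoset n y z → InCoset n x z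
  inCoset-trans {x} (a , refl) (b , refl) = b + a , sym (2^*-compose a b x)

  inCoset-sym : ∀ {x y} → x < n → InCoset n x y → InCoset n y x
  inCoset-sym {x} x<n (j , refl) = (h ∸ 1) * j , (begin
    2 ^ ((h ∸ 1) * j) * (2 ^ j * x % n) % n   ≡⟨ 2^*-compose j ((h ∸ 1) * j) x ⟩
    2 ^ ((h ∸ 1) * j + j) * x % n             ≡⟨ *-cong-mod (∣order⇒2^≡1 h∣) refl ⟩
    1 * x % n                                 ≡⟨ cong (_% n) (*-identityˡ x) ⟩
    x % n                                     ≡⟨ m<n⇒m%n≡m x<n ⟩
    x                                         ∎)
    where
    open ≡-Reasoning
    h∣ : h ∣ (h ∸ 1) * j + j
    h∣ = divides j (trans (+-comm ((h ∸ 1) * j) j) (trans (cong (_* j) (m+[n∸m]≡n (proj₁ h-order))) (*-comm h j)))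

  IsLeader : ℕ → Set
  IsLeader x = 1 ≤ x × (∀ {y} → y < x → 1 ≤ y → ¬ InCoset n y x)

  isLeader? : Decidable IsLeader
  isLeader? x = 1 ≤? x ×-dec allUpTo? (λ y → 1 ≤? y →-dec ¬? (inCoset? y x)) x

  leaders-distinct : ∀ {x y} → IsLeader x → IsLeader y → x < n → y < n → InCoset n x y → x ≡ y
  leaders-distinct {x} {y} (1≤x , x-least) (1≤y , y-least) x<n y<n x~y with <-cmp x y
  ... | tri< x<y _ _ = contradiction x~y (y-least x<y 1≤x)
  ... | tri≈ _ x≡y _ = x≡y
  ... | tri> _ _ y<x = contradiction (inCoset-sym x<n x~y) (x-least y<x 1≤y)

  leader-exists : ∀ {x} → 1 ≤ x → x < n → ∃ λ y → IsLeader y × y ≤ x × InCoset n y x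
  leader-exists {x} 1≤x x<n
    with y , (1≤y , y~x) , below ← minimal-exists (λ y → 1 ≤? y ×-dec inCoset? y x) (1≤x , inCoset-refl x<n) =
    y , (1≤y , λ z<y 1≤z z~y → below z<y (1≤z , inCoset-trans z~y y~x)) ,
    ≮⇒≥ (λ x<y → below x<y (1≤x , inCoset-refl x<n)) , y~x

  numCosets-exists : ∃ (IsNumCosets n)
  numCosets-exists = size , elem , bounds , distinct , covers
    where
    open Enumeration (enumerate isLeader? n)
    bounds : ∀ i → 1 ≤ elem i × elem i < n
    bounds i = proj₁ (elem∈Q i) , elem<M i
    distinct : ∀ i i′ → InCoset n (elem i) (elem i′) → i ≡ i′
    distinct i i′ c = injective (leaders-distinct (elem∈Q i) (elem∈Q i′) (elem<M i) (elem<M i′) c)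
    covers : ∀ x → 1 ≤ x → x < n → ∃ λ i → InCoset n (elem i) x
    covers x 1≤x x<n with y , y-leader , y≤x , y~x ← leader-exists 1≤x x<n
                     with i , refl ← complete (≤-<-trans y≤x x<n) y-leader = i , y~x

injective-avoiding⇒< : ∀ {N M} {s : Fin N → Fin M} {c} → Injective _≡_ _≡_ s → (∀ x → s x ≢ c) → N < M
injective-avoiding⇒< {s = s} {c} s-injective s≢c = Fin.injective⇒≤ c∷s-injective
  where
  c∷s-injective : Injective _≡_ _≡_ (c ∷ s)
  c∷s-injective {Fin.zero}  {Fin.zero}  _  = refl
  c∷s-injective {Fin.zero}  {Fin.suc y} eq = contradiction (sym eq) (s≢c y)
  c∷s-injective {Fin.suc x} {Fin.zero}  eq = contradiction eq (s≢c x)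
  c∷s-injective {Fin.suc x} {Fin.suc y} eq = cong Fin.suc (s-injective eq)

covering-collision⇒< : ∀ {N M} (g : Fin M → ℕ) {v : Fin N → ℕ} → Injective _≡_ _≡_ v
                     → (∀ x → ∃ λ a → g a ≡ v x) → ∀ {a b} → a ≢ b → g a ≡ g b → N < M
covering-collision⇒< {N} {M} g {v} v-injective covers {a} {b} a≢b ga≡gb =
  injective-avoiding⇒< s-injective (proj₂ missed)
  where
  open ≡-Reasoning
  s : Fin N → Fin M
  s x = proj₁ (covers x)
  gs≡v : ∀ x → g (s x) ≡ v x
  gs≡v x = proj₂ (covers x)
  s-injective : Injective _≡_ _≡_ s
  s-injective {x} {y} sx≡sy = v-injective (trans (sym (gs≡v x)) (trans (cong g sx≡sy) (gs≡v y)))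
  missed : ∃ λ c → ∀ x → s x ≢ c
  missed with Fin.any? (λ x → s x Fin.≟ a)
  ... | no  a∉s        = a , λ x sx≡a → a∉s (x , sx≡a)
  ... | yes (x , sx≡a) = b , λ y sy≡b → a≢b (trans (sym sx≡a) (trans (cong s (x≡y y sy≡b)) sy≡b))
    where
    x≡y : ∀ y → s y ≡ b → x ≡ y
    x≡y y sy≡b = v-injective (begin
      v x       ≡⟨ gs≡v x ⟨
      g (s x)   ≡⟨ cong g sx≡a ⟩
      g a       ≡⟨ ga≡gb ⟩
      g b       ≡⟨ cong g sy≡b ⟨
      g (s y)   ≡⟨ gs≡v y ⟩
      v y       ∎)

record ShortOrbit (n h : ℕ) .{{_ : NonZero n}} : Set where
  field
    {k x}   : ℕ
    1≤x     : 1 ≤ x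
    x<n     : x < n
    1≤k     : 1 ≤ k
    k<h     : k < h
    fixed   : 2 ^ k * x ≡ x [mod n ]

module _ {n : ℕ} .{{_ : NonZero n}} (n-odd : n % 2 ≡ 1) {h : ℕ} (h-order : IsOrder2 n h) where

  open Order h-order

  fixed-along-coset : ∀ {k x y} → InCoset n y x → 2 ^ k * x ≡ x [mod n ] → 2 ^ k * y ≡ y [mod n ]
  fixed-along-coset {k} {y = y} (j , refl) fixed = *-cancelˡ-2^-mod n-odd j (begin
    2 ^ j * (2 ^ k * y) % n        ≡⟨ cong (_% n) (x∙yz≈y∙xz (2 ^ j) (2 ^ k) y) ⟩
    2 ^ k * (2 ^ j * y) % n        ≡⟨ *-congˡ-mod (2 ^ k) (%-≡-mod (2 ^ j * y)) ⟨
    2 ^ k * (2 ^ j * y % n) % n    ≡⟨ fixed ⟩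
    2 ^ j * y % n % n              ≡⟨ %-≡-mod (2 ^ j * y) ⟩
    2 ^ j * y % n                  ∎)
    where
    open ≡-Reasoning

  module _ {r : ℕ} (rep : Fin r → ℕ) where

    orbitMap : Fin (r * h) → ℕ
    orbitMap a = 2 ^ toℕ (proj₂ (remQuot {r} h a)) * rep (proj₁ (remQuot {r} h a)) % n

    orbitMap-combine : ∀ i {j} (j<h : j < h) → orbitMap (combine i (Fin.fromℕ< j<h)) ≡ 2 ^ j * rep i % n
    orbitMap-combine i {j} j<h = begin
      orbitMap (combine i (Fin.fromℕ< j<h))    ≡⟨ cong (λ (i , j) → 2 ^ toℕ j * rep i % n) (Fin.remQuot-combine {r} {h} i _) ⟩
      2 ^ toℕ (Fin.fromℕ< j<h) * rep i % n     ≡⟨ cong (λ e → 2 ^ e * rep i % n) (Fin.toℕ-fromℕ< j<h) ⟩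
      2 ^ j * rep i % n                        ∎
      where open ≡-Reasoning

    orbitMap-covers : (∀ x → 1 ≤ x → x < n → ∃ λ i → InCoset n (rep i) x)
                    → ∀ (y : Fin (pred n)) → ∃ λ a → orbitMap a ≡ suc (toℕ y)
    orbitMap-covers covers y
      with i , j , e ← covers (suc (toℕ y)) (s≤s z≤n) (subst (suc (toℕ y) <_) (suc-pred n) (s≤s (Fin.toℕ<n y))) =
      combine i (Fin.fromℕ< (m%n<n j h)) , (begin
        orbitMap (combine i (Fin.fromℕ< (m%n<n j h)))  ≡⟨ orbitMap-combine i (m%n<n j h) ⟩
        2 ^ (j % h) * rep i % n                       ≡⟨ *-cong-mod (2^≡2^%order j) refl ⟨
        2 ^ j * rep i % n                             ≡⟨ e ⟩
        suc (toℕ y)                                   ∎)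
      where open ≡-Reasoning

    orbitMap-collision : ∀ {i k} (0<h : 0 < h) (k<h : k < h) → 2 ^ k * rep i ≡ rep i [mod n ]
                       → orbitMap (combine i (Fin.fromℕ< 0<h)) ≡ orbitMap (combine i (Fin.fromℕ< k<h))
    orbitMap-collision {i} {k} 0<h k<h fixed = begin
      orbitMap (combine i (Fin.fromℕ< 0<h))   ≡⟨ orbitMap-combine i 0<h ⟩
      1 * rep i % n                          ≡⟨ cong (_% n) (*-identityˡ (rep i)) ⟩
      rep i % n                              ≡⟨ fixed ⟨
      2 ^ k * rep i % n                      ≡⟨ orbitMap-combine i k<h ⟨
      orbitMap (combine i (Fin.fromℕ< k<h))   ∎
      where open ≡-Reasoning

  shortOrbit⇒n≤r*h : ∀ {r} → IsNumCosets n r → ShortOrbit n h → n ≤ r * h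
  shortOrbit⇒n≤r*h {r} (rep , _ , _ , covers) short =
    subst (_≤ r * h) (suc-pred n)
      (covering-collision⇒< (orbitMap rep) (Fin.toℕ-injective ∘ suc-injective) (orbitMap-covers rep covers)
        0≢k (orbitMap-collision rep 0<h k<h (fixed-along-coset {k} x∈coset fixed)))
    where
    open ShortOrbit short
    i₀ : Fin r
    i₀ = proj₁ (covers x 1≤x x<n)
    x∈coset : InCoset n (rep i₀) x
    x∈coset = proj₂ (covers x 1≤x x<n)
    0<h : 0 < h
    0<h = <-≤-trans 1≤k (<⇒≤ k<h)
    0≢k : combine i₀ (Fin.fromℕ< 0<h) ≢ combine i₀ (Fin.fromℕ< k<h)
    0≢k eq = <⇒≢ 1≤k (Fin.fromℕ<-injective 0 k 0<h k<h (Fin.combine-injectiveʳ i₀ _ i₀ _ eq))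

order-∣-order : ∀ {d m k h} .{{_ : NonZero d}} .{{_ : NonZero m}} → d ∣ m → IsOrder2 d k → IsOrder2 m h → k ∣ h
order-∣-order d∣m k-order h-order = Order.2^≡1⇒order∣ k-order (≡-mod-∣ d∣m (proj₁ (proj₂ h-order)))

order-lifts⇒wieferich : ∀ {p k} .{{_ : NonZero p}} .{{_ : NonZero (p * p)}} → Prime p → p % 2 ≡ 1 → IsOrder2 p k
                      → 2 ^ k ≡ 1 [mod p * p ] → Wieferich p
order-lifts⇒wieferich {p@(suc q)} {k} p-prime p-odd k-order 2^k≡1 =
  p-prime , ≡1-mod⇒∣∸1 (<-≤-trans p>1 (m≤m*n p p)) {2 ^ q} (∣⇒^≡1-mod 2^k≡1 k∣q)
  where
  p>1 : 1 < p
  p>1 = nonTrivial⇒n>1 p {{prime⇒nonTrivial p-prime}}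
  k∣q : k ∣ q
  k∣q = Order.2^≡1⇒order∣ k-order (*-cancelˡ-2-mod p-odd {2 ^ q} {1} (fermat p-prime))

cofactor-fixed : ∀ {a p n} .{{_ : NonZero p}} .{{_ : NonZero n}} → 1 < p → (p∣n : p ∣ n)
               → a ≡ 1 [mod p ] → a * _∣_.quotient p∣n ≡ _∣_.quotient p∣n [mod n ]
cofactor-fixed {a} {p} p>1 (divides q refl) a≡1 = begin
  a * q % (q * p)                      ≡⟨ cong (λ a → a * q % (q * p)) a≡1+tp ⟩
  (1 + a / p * p) * q % (q * p)        ≡⟨ cong (_% (q * p)) (identity (a / p) p q) ⟩
  (q + a / p * (q * p)) % (q * p)      ≡⟨ [m+kn]%n≡m%n q (a / p) (q * p) ⟩
  q % (q * p)                          ∎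
  where
  open ≡-Reasoning
  a≡1+tp : a ≡ 1 + a / p * p
  a≡1+tp = trans (m≡m%n+[m/n]*n a p) (cong (_+ a / p * p) (trans a≡1 (m<n⇒m%n≡m p>1)))
  identity : ∀ t p q → (1 + t * p) * q ≡ q + t * (q * p)
  identity = solve-∀

cofactor-bounds : ∀ {p n} .{{_ : NonZero n}} → 1 < p → (p∣n : p ∣ n) → 1 ≤ _∣_.quotient p∣n × _∣_.quotient p∣n < n
cofactor-bounds         p>1 (divides zero    refl) = contradiction refl (≢-nonZero⁻¹ 0)
cofactor-bounds {p = p} p>1 (divides (suc q) refl) = s≤s z≤n , m<m*n (suc q) p p>1

squareDivisor⇒shortOrbit : ∀ {n h p} .{{_ : NonZero n}} → n % 2 ≡ 1 → IsOrder2 n h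
                         → Prime p → p * p ∣ n → ¬ Wieferich p → ShortOrbit n h
squareDivisor⇒shortOrbit {n} {h} {p} n-odd h-order p-prime p²∣n not-wieferich = record
  { 1≤x = proj₁ (cofactor-bounds p>1 p∣n)
  ; x<n = proj₂ (cofactor-bounds p>1 p∣n)
  ; 1≤k = proj₁ k-order
  ; k<h = ≤∧≢⇒< (∣⇒≤ (order-∣-order p∣n k-order h-order)) k≢h
  ; fixed = cofactor-fixed p>1 p∣n (proj₁ (proj₂ k-order))
  }
  where
  instance
    p≢0 : NonZero p
    p≢0 = prime⇒nonZero p-prime
    p²≢0 : NonZero (p * p)
    p²≢0 = m*n≢0 p p
  open Order h-order using (order-nonZero)
  p>1 : 1 < p
  p>1 = nonTrivial⇒n>1 p {{prime⇒nonTrivial p-prime}}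
  p∣n : p ∣ n
  p∣n = ∣-trans (m∣m*n p) p²∣n
  p-odd : p % 2 ≡ 1
  p-odd = ∣-odd p∣n n-odd
  k : ℕ
  k = proj₁ (order-exists {p} p-odd)
  k-order : IsOrder2 p k
  k-order = proj₂ (order-exists {p} p-odd)
  k≢h : k ≢ h
  k≢h k≡h = not-wieferich (order-lifts⇒wieferich p-prime p-odd k-order
    (≡-mod-∣ p²∣n (subst (λ e → 2 ^ e ≡ 1 [mod n ]) (sym k≡h) (proj₁ (proj₂ h-order)))))

theorem5 : (n : ℕ) → .{{_ : NonZero n}} → 1 < n → n % 2 ≡ 1 → Composite n
         → (∀ r h → IsNumCosets n r → IsOrder2 n h → n ≡ r * h + 1)
         → (∀ p → Wieferich p → ¬ (p * p ∣ n))
         → SquareFree n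
theorem5 n _ n-odd _ overpseudoprime no-wieferich p p-prime p²∣n
  with h , h-order  ← order-exists {n} n-odd
  with r , r-cosets ← Cosets.numCosets-exists h-order = m+1+n≰m (r * h) (begin
    r * h + 1 ≡⟨ overpseudoprime r h r-cosets h-order ⟨
    n         ≤⟨ shortOrbit⇒n≤r*h n-odd h-order r-cosets short ⟩
    r * h     ∎)
  where
  open ≤-Reasoning
  short : ShortOrbit n h
  short = squareDivisor⇒shortOrbit n-odd h-order p-prime p²∣n (λ w → no-wieferich p w p²∣n)
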